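{- For each $\alpha > 0$ and $r, t \in \mathbb{N}$ there exist $c = c_2(\alpha,r,t) \in \mathbb{N}$ and $\delta = \delta_2(c,\alpha,r,t) > 0$ such that the following holds. Let $G$ be a graph on $n \in \mathbb{N}$ vertices, let $(S_1, \ldots, S_r)$ be a partition of $V(G)$, and let $B \subset V(G)$ satisfy $|B| \geqslant c$ and $$\big| (\Gamma(b) \cap S_j) \triangle (\Gamma(b') \cap S_j) \big| \geqslant \alpha n$$ for every $j \in [r]$ and all distinct $b, b' \in B$. Then there exist a subset $B' \subset B$ with $|B'| = t$ and, for each $i \in [r]$, sets $T^{(i)}_1, \ldots, T^{(i)}_{2^t} \subset S_i$ with $|T^{(i)}_j| \geqslant \delta n$, such that: (a) if $u, v \in T^{(i)}_j$ then $\Gamma(u) \cap B' = \Gamma(v) \cap B'$; (b) if $W = \{w_1, \ldots, w_{2^t}\}$ with $w_j \in T^{(1)}_j \cup \cdots \cup T^{(r)}_j$ for each $j \in [2^t]$, then $W \to B'$.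
   Context: $\Gamma(x)$ denotes the neighbourhood of a vertex $x$. For vertex sets $X, Y$, $X \to Y$ means that for every $S \subseteq Y$ there exists $x \in X$ with $\Gamma(x) \cap Y = S$.
   Formalization: The parameter α ranges over the positive rationals. -}

module Defs where

open import Data.Nat using (ℕ)
open import Data.Bool using (Bool; true)
open import Data.Fin using (Fin)
open import Data.Fin.Subset using (Subset; _∩_; _∪_; _─_; _∈_; ∣_∣)
open import Data.Vec using (tabulate)
open import Data.Integer using (+_)
open import Data.Rational using (ℚ; _/_; _*_; _≤_)
open import Relation.Binary.PropositionalEquality using (_≡_)
open import Relation.Nullary using (¬_)
open import Data.Product using (∃)
open import Data.Fin using (_≟_)
open import Relation.Nullary.Decidable using (⌊_⌋)

record Graph (n : ℕ) : Set where
  field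
    adj   : Fin n → Fin n → Bool
    sym   : ∀ u v → adj u v ≡ adj v u
    irrefl : ∀ v → adj v v ≡ Data.Bool.false

open Graph public

Γ : ∀ {n} → Graph n → Fin n → Subset n
Γ G x = tabulate (adj G x)

_△_ : ∀ {n} → Subset n → Subset n → Subset n
X △ Y = (X ─ Y) ∪ (Y ─ X)

-- The part S_j of the partition given by an assignment part : V(G) → [r].
part : ∀ {n r} → (Fin n → Fin r) → Fin r → Subset n
part P j = tabulate (λ v → ⌊ P v ≟ j ⌋)

ℕ→ℚ : ℕ → ℚ
ℕ→ℚ m = (+ m) / 1

-- X → Y : every S ⊆ Y is cut out as Γ(x) ∩ Y for some x ∈ X.
Shatters : ∀ {n} → Graph n → Subset n → Subset n → Set
Shatters G X Y = ∀ S → S Data.Fin.Subset.⊆ Y → ∃ λ x → x ∈ X × (Γ G x ∩ Y ≡ S)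
  where open import Data.Product using (_×_)

image : ∀ {m n} → (Fin m → Fin n) → Subset n
image w = tabulate (λ v → ⌊ Data.Fin.Properties.any? (λ j → w j ≟ v) ⌋)
  where import Data.Fin.Properties

module Submission where

-- Vertex sets are handled as characteristic functions ("cells") counted by ∑;
-- two neighbourhoods are far in a cell if their symmetric difference in it is
-- large.  The core (lemma 'selection') is an induction on t over families of m
-- cells, initially the parts S_j.  Its step is a density-increment argument
-- (module DensityIncrement): with two Ramsey-type selection principles on lists
-- ('multiCluster', 'discard') we find a pivot b and many further points that
-- stay far apart in all 2m halves C ∩ Γ(b), C ∖ Γ(b) of slightly shrunk cells,
-- and induction on these halves selects the remaining t points.

module Shattering where

  open import Data.Bool using (Bool; true; false; not; _∧_; _∨_; _xor_)
  open import Data.Bool.Properties using (∧-zeroʳ; xor-comm)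
  open import Data.Empty using (⊥; ⊥-elim)
  open import Data.Fin using (Fin; zero; suc; splitAt; _↑ˡ_; _↑ʳ_; finToFun; funToFin)
  open import Data.Fin.Properties
    using (_≟_; any?; ¬Fin0; suc-injective; splitAt-↑ˡ; splitAt-↑ʳ; finToFun-funToFin)
  open import Data.Fin.Subset using (Subset; _∩_; _∈_; _⊆_; ∣_∣)
  import Data.Integer as ℤ
  open import Data.Integer.Properties using (pos-*; drop‿+≤+) renaming (*-identityʳ to ℤ*-identityʳ)
  open import Data.List using (List; []; _∷_; length; filter)
  import Data.List as List
  open import Data.List.Properties using (filter-all; length-map)
  open import Data.List.Membership.Propositional using () renaming (_∈_ to _∈ˡ_)
  open import Data.List.Relation.Binary.Sublist.Propositional
    using ([]; _∷_; _∷ʳ_; ⊆-refl; ⊆-trans; minimum) renaming (_⊆_ to _⊑_)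
  import Data.List.Relation.Binary.Sublist.Propositional as Sublist
  open import Data.List.Relation.Binary.Sublist.Propositional.Properties using (All-resp-⊆; filter-⊆; ∷ˡ⁻)
  open import Data.List.Relation.Unary.All as All using (All; []; _∷_)
  open import Data.List.Relation.Unary.All.Properties using (all-filter) renaming (map⁺ to All-map⁺)
  open import Data.List.Relation.Unary.AllPairs as AllPairs using (AllPairs; []; _∷_)
  open import Data.List.Relation.Unary.AllPairs.Properties using ()
    renaming (filter⁺ to AllPairs-filter⁺; map⁺ to AllPairs-map⁺)
  open import Data.List.Relation.Unary.Any using (here; there)
  open import Data.Nat using (ℕ; zero; suc; _+_; _*_; _^_; _≤_; _<_; z≤n; s≤s; NonZero)
  open import Data.Nat.Properties
    using ( _≤?_; _<?_; module ≤-Reasoning; ≤-refl; ≤-reflexive; ≤-trans; ≤-pred; <⇒≤; ≮⇒≥; ≰⇒>; <-irrefl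
          ; n≮0; n≤0⇒n≡0; n≤1+n; m≤m+n; m≤n+m; m≤n*m; +-comm; +-assoc; +-suc; +-identityʳ; +-commutativeSemigroup
          ; +-mono-≤; +-monoˡ-≤; +-monoʳ-≤; +-mono-<; +-mono-<-≤; +-cancelˡ-≤; +-cancelʳ-≤; +-cancelʳ-≡
          ; *-assoc; *-comm; *-identityˡ; *-identityʳ; *-distribˡ-+; *-monoˡ-≤; *-monoʳ-≤; *-monoʳ-<
          ; *-cancelˡ-<; m*n≢0 )
  open import Algebra.Properties.CommutativeSemigroup +-commutativeSemigroup using (interchange)
  open import Data.Nat.Tactic.RingSolver using (solve-∀)
  open import Data.Product using (∃-syntax; _×_; _,_; proj₁; proj₂)
  open import Data.Rational using (ℚ; mkℚ; Positive; toℚᵘ; fromℚᵘ) renaming (_*_ to _*ℚ_; _≤_ to _≤ℚ_)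
  open import Data.Rational.Properties
    using (toℚᵘ-fromℚᵘ; toℚᵘ-homo-*; toℚᵘ-mono-≤; toℚᵘ-cancel-≤; normalize-pos)
  open import Data.Rational.Unnormalised using (mkℚᵘ; *≤*) renaming (_≃_ to _≃ᵘ_; _*_ to _*ᵘ_)
  open import Data.Rational.Unnormalised.Properties using ()
    renaming ( ≤-respˡ-≃ to ≤ᵘ-respˡ-≃ᵘ; ≤-respʳ-≃ to ≤ᵘ-respʳ-≃ᵘ; ≃-refl to ≃ᵘ-refl; ≃-trans to ≃ᵘ-trans
             ; ≃-sym to ≃ᵘ-sym; *-cong to *ᵘ-cong )
  open import Data.Sum using (_⊎_; inj₁; inj₂; [_,_]′)
  open import Data.Vec using ([]; _∷_; lookup; tabulate; here; there)
  open import Data.Vec.Properties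
    using (lookup-zipWith; lookup∘tabulate; tabulate∘lookup; tabulate-cong; []=⇒lookup; lookup⇒[]=)
  open import Data.Vec.Functional using (updateAt)
  import Data.Vec.Functional as Vector
  open import Data.Vec.Functional.Properties using (updateAt-updates; updateAt-minimal)
  open import Function using (_∘_; case_of_)
  open import Relation.Binary using () renaming (Decidable to Decidable²)
  open import Relation.Binary.PropositionalEquality
  open import Relation.Nullary using (¬_; Dec; yes; no; ¬?)
  open import Relation.Nullary.Decidable using (⌊_⌋)
  open import Relation.Unary using () renaming (Decidable to Decidable¹)
  open import Defs using (Graph; adj; Γ; _△_; part; ℕ→ℚ; Shatters; image)

  private
    variable
      n : ℕ
      A : Set

  ∑ : (Fin n → ℕ) → ℕ
  ∑ {zero}  f = 0
  ∑ {suc n} f = f zero + ∑ (f ∘ suc)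

  indicator : Bool → ℕ
  indicator true  = 1
  indicator false = 0

  Cell : ℕ → Set
  Cell n = Fin n → Bool

  count : Cell n → ℕ
  count C = ∑ (indicator ∘ C)

  ∑-cong : {f g : Fin n → ℕ} → (∀ v → f v ≡ g v) → ∑ f ≡ ∑ g
  ∑-cong {zero}  eq = refl
  ∑-cong {suc n} eq = cong₂ _+_ (eq zero) (∑-cong (eq ∘ suc))

  ∑-mono-≤ : {f g : Fin n → ℕ} → (∀ v → f v ≤ g v) → ∑ f ≤ ∑ g
  ∑-mono-≤ {zero}  le = z≤n
  ∑-mono-≤ {suc n} le = +-mono-≤ (le zero) (∑-mono-≤ (le ∘ suc))

  ∑-distrib-+ : (f g : Fin n → ℕ) → ∑ (λ v → f v + g v) ≡ ∑ f + ∑ g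
  ∑-distrib-+ {zero}  f g = refl
  ∑-distrib-+ {suc n} f g =
    trans (cong (f zero + g zero +_) (∑-distrib-+ (f ∘ suc) (g ∘ suc)))
          (interchange (f zero) (g zero) (∑ (f ∘ suc)) (∑ (g ∘ suc)))

  ∑-≤-const : (f : Fin n → ℕ) (c : ℕ) → (∀ v → f v ≤ c) → ∑ f ≤ n * c
  ∑-≤-const {zero}  f c le = z≤n
  ∑-≤-const {suc n} f c le = +-mono-≤ (le zero) (∑-≤-const (f ∘ suc) c (le ∘ suc))

  ∑-updateAt : {m : ℕ} (g : A → ℕ) (xs : Fin m → A) (k : Fin m) (f : A → A) →
               ∑ (g ∘ updateAt xs k f) + g (xs k) ≡ ∑ (g ∘ xs) + g (f (xs k))
  ∑-updateAt g xs zero f = swap-ends (g (f (xs zero))) (∑ (g ∘ xs ∘ suc)) (g (xs zero))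
    where
    swap-ends : ∀ a b c → a + b + c ≡ c + b + a
    swap-ends = solve-∀
  ∑-updateAt g xs (suc k) f = begin
    g (xs zero) + ∑ (g ∘ updateAt (xs ∘ suc) k f) + g (xs (suc k))
      ≡⟨ +-assoc (g (xs zero)) _ _ ⟩
    g (xs zero) + (∑ (g ∘ updateAt (xs ∘ suc) k f) + g (xs (suc k)))
      ≡⟨ cong (g (xs zero) +_) (∑-updateAt g (xs ∘ suc) k f) ⟩
    g (xs zero) + (∑ (g ∘ xs ∘ suc) + g (f (xs (suc k))))
      ≡⟨ +-assoc (g (xs zero)) _ _ ⟨
    g (xs zero) + ∑ (g ∘ xs ∘ suc) + g (f (xs (suc k))) ∎
    where open ≡-Reasoning

  count-cong : {C D : Cell n} → (∀ v → C v ≡ D v) → count C ≡ count D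
  count-cong same = ∑-cong (cong indicator ∘ same)

  _⊆ᶜ_ : Cell n → Cell n → Set
  C ⊆ᶜ D = ∀ v → C v ≡ true → D v ≡ true

  count-mono : {C D : Cell n} → C ⊆ᶜ D → count C ≤ count D
  count-mono {C = C} {D} C⊆D = ∑-mono-≤ pointwise
    where
    pointwise : ∀ v → indicator (C v) ≤ indicator (D v)
    pointwise v with C v | C⊆D v
    ... | false | _     = z≤n
    ... | true  | C⊆D-v rewrite C⊆D-v refl = ≤-refl

  count-cover : {C D E : Cell n} → (∀ v → C v ≡ true → D v ∨ E v ≡ true) →
                count C ≤ count D + count E
  count-cover {C = C} {D} {E} cover =
    ≤-trans (∑-mono-≤ pointwise) (≤-reflexive (∑-distrib-+ (indicator ∘ D) (indicator ∘ E)))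
    where
    pointwise : ∀ v → indicator (C v) ≤ indicator (D v) + indicator (E v)
    pointwise v with C v | D v | E v | cover v
    ... | false | _     | _     | _ = z≤n
    ... | true  | true  | _     | _ = s≤s z≤n
    ... | true  | false | true  | _ = s≤s z≤n
    ... | true  | false | false | c = case c refl of λ ()

  count-partition : {C D E : Cell n} → (∀ v → C v ≡ D v ∨ E v) → (∀ v → D v ∧ E v ≡ false) →
                    count C ≡ count D + count E
  count-partition {C = C} {D} {E} union disjoint =
    trans (∑-cong pointwise) (∑-distrib-+ (indicator ∘ D) (indicator ∘ E))
    where
    pointwise : ∀ v → indicator (C v) ≡ indicator (D v) + indicator (E v)
    pointwise v rewrite union v with D v | E v | disjoint v
    ... | true  | true  | ()
    ... | true  | false | _ = refl
    ... | false | _     | _ = refl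

  count≤n : (C : Cell n) → count C ≤ n
  count≤n {n} C = ≤-trans (∑-≤-const (indicator ∘ C) 1 bound) (≤-reflexive (*-identityʳ n))
    where
    bound : ∀ v → indicator (C v) ≤ 1
    bound v with C v
    ... | true  = ≤-refl
    ... | false = z≤n

  agree : Bool → Bool → Bool
  agree true  a = a
  agree false a = not a

  side : Bool → Cell n → Cell n → Cell n
  side σ C N v = C v ∧ agree σ (N v)

  side-⊆ : (σ : Bool) (C N : Cell n) → side σ C N ⊆ᶜ C
  side-⊆ σ C N v C∧a≡true with C v
  ... | true = refl

  side-mono : (σ : Bool) {C D : Cell n} (N : Cell n) → C ⊆ᶜ D → side σ C N ⊆ᶜ side σ D N
  side-mono σ {C} N C⊆D v C∧a≡true with C v in Cv
  ... | true rewrite C⊆D v Cv = C∧a≡true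

  count-split : (σ : Bool) (C N : Cell n) → count C ≡ count (side σ C N) + count (side (not σ) C N)
  count-split σ C N = count-partition (λ v → union σ (C v) (N v)) (λ v → disjoint σ (C v) (N v))
    where
    union : ∀ σ c a → c ≡ (c ∧ agree σ a) ∨ (c ∧ agree (not σ) a)
    union σ     false a     = refl
    union true  true  true  = refl
    union true  true  false = refl
    union false true  true  = refl
    union false true  false = refl
    disjoint : ∀ σ c a → (c ∧ agree σ a) ∧ (c ∧ agree (not σ) a) ≡ false
    disjoint σ     false a     = refl
    disjoint true  true  true  = refl
    disjoint true  true  false = refl
    disjoint false true  true  = refl
    disjoint false true  false = refl

  dist : Cell n → Cell n → Cell n → ℕ
  dist C X Y = count (λ v → C v ∧ (X v xor Y v))

  dist-split : (σ : Bool) (C N X Y : Cell n) →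
               dist C X Y ≡ dist (side σ C N) X Y + dist (side (not σ) C N) X Y
  dist-split σ C N X Y =
    count-partition (λ v → union σ (C v) (N v) (X v xor Y v)) (λ v → disjoint σ (C v) (N v) (X v xor Y v))
    where
    union : ∀ σ c a e → c ∧ e ≡ ((c ∧ agree σ a) ∧ e) ∨ ((c ∧ agree (not σ) a) ∧ e)
    union σ     false a     e     = refl
    union true  true  true  true  = refl
    union true  true  true  false = refl
    union true  true  false true  = refl
    union true  true  false false = refl
    union false true  true  true  = refl
    union false true  true  false = refl
    union false true  false true  = refl
    union false true  false false = refl
    disjoint : ∀ σ c a e → ((c ∧ agree σ a) ∧ e) ∧ ((c ∧ agree (not σ) a) ∧ e) ≡ false
    disjoint σ     false a     e     = refl
    disjoint true  true  true  e     = ∧-zeroʳ e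
    disjoint true  true  false e     = refl
    disjoint false true  true  e     = refl
    disjoint false true  false e     = ∧-zeroʳ e

  dist-sym : (C X Y : Cell n) → dist C X Y ≡ dist C Y X
  dist-sym C X Y = count-cong (λ v → cong (C v ∧_) (xor-comm (X v) (Y v)))

  dist-triangle : (C X Y Z : Cell n) → dist C X Z ≤ dist C X Y + dist C Y Z
  dist-triangle C X Y Z = count-cover (λ v → cover (C v) (X v) (Y v) (Z v))
    where
    cover : ∀ c x y z → c ∧ (x xor z) ≡ true → (c ∧ (x xor y)) ∨ (c ∧ (y xor z)) ≡ true
    cover true true  true  z h = h
    cover true true  false z h = refl
    cover true false true  z h = refl
    cover true false false z h = h

  dist≤count : (C X Y : Cell n) → dist C X Y ≤ count C
  dist≤count C X Y = count-mono λ v → proj-∧ (C v)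
    where
    proj-∧ : ∀ c {e} → c ∧ e ≡ true → c ≡ true
    proj-∧ true _ = refl

  dist-≤-sides : (σ : Bool) (C X Y : Cell n) → dist C X Y ≤ count (side σ C X) + count (side σ C Y)
  dist-≤-sides σ C X Y = count-cover (λ v → cover σ (C v) (X v) (Y v))
    where
    cover : ∀ σ c x y → c ∧ (x xor y) ≡ true → (c ∧ agree σ x) ∨ (c ∧ agree σ y) ≡ true
    cover true  true true  y     h = refl
    cover true  true false true  h = refl
    cover false true true  false h = refl
    cover false true false y     h = refl

  AllPairs-resp-⊑ : {R : A → A → Set} {xs ys : List A} → xs ⊑ ys → AllPairs R ys → AllPairs R xs
  AllPairs-resp-⊑ []         []       = []
  AllPairs-resp-⊑ (_ ∷ʳ xs⊑ys) (_ ∷ ps) = AllPairs-resp-⊑ xs⊑ys ps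
  AllPairs-resp-⊑ (refl ∷ xs⊑ys) (p ∷ ps) = All-resp-⊆ xs⊑ys p ∷ AllPairs-resp-⊑ xs⊑ys ps

  AllPairs-universal : {R : A → A → Set} → (∀ x y → R x y) → (xs : List A) → AllPairs R xs
  AllPairs-universal r []       = []
  AllPairs-universal r (x ∷ xs) = All.universal (r x) xs ∷ AllPairs-universal r xs

  length-filter-split : {P : A → Set} (P? : Decidable¹ P) (xs : List A) →
                        length (filter P? xs) + length (filter (¬? ∘ P?) xs) ≡ length xs
  length-filter-split P? []       = refl
  length-filter-split P? (x ∷ xs) with P? x
  ... | yes _ = cong suc (length-filter-split P? xs)
  ... | no  _ = trans (+-suc _ _) (cong suc (length-filter-split P? xs))

  AllPairs-distinct : {P : A → Set} {R : A → A → Set} {xs : List A} → All P xs → AllPairs _≢_ xs →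
                      (∀ {x y} → P x → P y → x ≢ y → R x y) → AllPairs (λ x y → x ≢ y × R x y) xs
  AllPairs-distinct []         []                 related = []
  AllPairs-distinct (px ∷ pxs) (x≢xs ∷ distinct) related =
    All.zipWith (λ (py , x≢y) → x≢y , related px py x≢y) (pxs , x≢xs) ∷ AllPairs-distinct pxs distinct related

  record Clique (R : A → A → Set) (L : ℕ) (xs : List A) : Set where
    constructor clique
    field
      members : List A
      ⊑xs     : members ⊑ xs
      size    : L ≤ length members
      pairs   : AllPairs R members

  clique-within : {R : A → A → Set} {L : ℕ} {xs ys : List A} → xs ⊑ ys → Clique R L xs → Clique R L ys
  clique-within xs⊑ys (clique zs zs⊑xs size pairs) = clique zs (⊆-trans zs⊑xs xs⊑ys) size pairs

  -- Greedily pick a centre x: either its close points form a Near-clique of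
  -- size L, or x is kept and we continue among the points not close to x.
  module Clustering {Close Near : A → A → Set} (close? : Decidable² Close)
                    (close⇒near : ∀ {x y} → Close x y → Near x y)
                    (near-via-centre : ∀ {x y z} → Close x y → Close x z → Near y z) where

    around-centre : (x : A) (ys : List A) → All (Close x) ys → AllPairs Near (x ∷ ys)
    around-centre x ys close = All.map close⇒near close ∷ pairs ys close
      where
      pairs : (ys : List A) → All (Close x) ys → AllPairs Near ys
      pairs []       []           = []
      pairs (y ∷ ys) (cy ∷ close) = All.map (near-via-centre cy) close ∷ pairs ys close

    cluster : (k L : ℕ) (xs : List A) → k * L ≤ length xs →
              Clique (λ x y → ¬ Close x y) k xs ⊎ Clique Near L xs
    cluster zero    L       xs         _    = inj₁ (clique [] (minimum xs) z≤n [])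
    cluster (suc k) zero    xs         _    = inj₂ (clique [] (minimum xs) z≤n [])
    cluster (suc k) (suc L) (x ∷ rest) size with suc L ≤? length (x ∷ filter (close? x) rest)
    ... | yes big = inj₂ (clique (x ∷ filter (close? x) rest) (refl ∷ filter-⊆ (close? x) rest) big
                                 (around-centre x _ (all-filter (close? x) rest)))
    ... | no small with cluster k (suc L) far far-size
      where
      far = filter (¬? ∘ close? x) rest
      -- the centre has fewer than L close points, so the far points are numerous
      far-size : k * suc L ≤ length far
      far-size = +-cancelˡ-≤ (suc (length (filter (close? x) rest))) _ _ (begin
        suc (length (filter (close? x) rest)) + k * suc L ≤⟨ +-monoˡ-≤ _ (<⇒≤ (≰⇒> small)) ⟩
        suc L + k * suc L                                   ≤⟨ size ⟩
        suc (length rest)                                   ≡⟨ cong suc (length-filter-split (close? x) rest) ⟨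
        suc (length (filter (close? x) rest)) + length far ∎)
        where open ≤-Reasoning
    ...   | inj₁ (clique ys ys⊑far size′ pairs) =
            inj₁ (clique (x ∷ ys) (refl ∷ ⊆-trans ys⊑far (filter-⊆ _ rest)) (s≤s size′)
                         (All-resp-⊆ ys⊑far (all-filter (¬? ∘ close? x) rest) ∷ pairs))
    ...   | inj₂ near = inj₂ (clique-within (x ∷ʳ filter-⊆ _ rest) near)

  multiCluster : (k : ℕ) {Close Near : Fin k → A → A → Set} → (∀ i → Decidable² (Close i)) →
                 (∀ i {x y} → Close i x y → Near i x y) →
                 (∀ i {x y z} → Close i x y → Close i x z → Near i y z) →
                 (L : ℕ) (xs : List A) → L ^ suc k ≤ length xs →
                 Clique (λ x y → ∀ i → ¬ Close i x y) L xs ⊎ ∃[ i ] Clique (Near i) L xs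
  multiCluster zero close? close⇒near near-via-centre L xs size =
    inj₁ (clique xs ⊆-refl (≤-trans (≤-reflexive (sym (*-identityʳ L))) size) (AllPairs-universal (λ _ _ ()) xs))
  multiCluster (suc k) {Close} close? close⇒near near-via-centre L xs size
    with Clustering.cluster (close? zero) (close⇒near zero) (near-via-centre zero) (L ^ suc k) L xs
           (≤-trans (≤-reflexive (*-comm (L ^ suc k) L)) size)
  ... | inj₂ near = inj₂ (zero , near)
  ... | inj₁ (clique ys ys⊑xs size′ far₀)
    with multiCluster k (close? ∘ suc) (close⇒near ∘ suc) (near-via-centre ∘ suc) L ys size′
  ...   | inj₂ (i , near) = inj₂ (suc i , clique-within ys⊑xs near)
  ...   | inj₁ (clique zs zs⊑ys size″ far) =
          inj₁ (clique zs (⊆-trans zs⊑ys ys⊑xs) size″ (AllPairs.zipWith far-all (AllPairs-resp-⊑ zs⊑ys far₀ , far)))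
    where
    far-all : ∀ {x y} → ¬ Close zero x y × (∀ i → ¬ Close (suc i) x y) → ∀ i → ¬ Close i x y
    far-all (far₀ , far) zero    = far₀
    far-all (far₀ , far) (suc i) = far i

  at-most-one-bad : {R : A → A → Set} {Bad : A → Set} (bad? : Decidable¹ Bad) →
                    (∀ {x y} → R x y → Bad x → Bad y → ⊥) → (xs : List A) → AllPairs R xs →
                    length xs ≤ suc (length (filter (¬? ∘ bad?) xs))
  at-most-one-bad bad? exclusive []       []           = z≤n
  at-most-one-bad {R = R} {Bad = Bad} bad? exclusive (x ∷ xs) (rx ∷ pairs) with bad? x
  ... | no  _     = s≤s (at-most-one-bad bad? exclusive xs pairs)
  ... | yes bad-x = s≤s (≤-reflexive (sym (cong length (filter-all (¬? ∘ bad?) (All.map (exclusive′) rx)))))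
    where
    exclusive′ : ∀ {y} → R x y → ¬ Bad y
    exclusive′ rxy = exclusive rxy bad-x

  discard : (k : ℕ) {R : A → A → Set} {Bad : Fin k → A → Set} → (∀ i → Decidable¹ (Bad i)) →
            (∀ {x y} → R x y → ∀ i → Bad i x → Bad i y → ⊥) → (xs : List A) → AllPairs R xs →
            ∃[ ys ] (ys ⊑ xs × length xs ≤ k + length ys × All (λ y → ∀ i → ¬ Bad i y) ys)
  discard zero    bad? exclusive xs pairs = xs , ⊆-refl , ≤-refl , All.universal (λ _ ()) xs
  discard (suc k) {Bad = Bad} bad? exclusive xs pairs
    with discard k (bad? ∘ suc) (λ r → exclusive r ∘ suc) (filter (¬? ∘ bad? zero) xs)
                   (AllPairs-filter⁺ (¬? ∘ bad? zero) pairs)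
  ... | ys , ys⊑good , size , good =
    ys , ⊆-trans ys⊑good (filter-⊆ _ xs) , size′ , All.zipWith good-all (All-resp-⊆ ys⊑good (all-filter _ xs) , good)
    where
    size′ : length xs ≤ suc k + length ys
    size′ = ≤-trans (at-most-one-bad (bad? zero) (λ r → exclusive r zero) xs pairs) (s≤s size)
    good-all : ∀ {y} → ¬ Bad zero y × (∀ i → ¬ Bad (suc i) y) → ∀ i → ¬ Bad i y
    good-all (good₀ , good) zero    = good₀
    good-all (good₀ , good) (suc i) = good i

  Separated : (adj : Fin n → Fin n → Bool) (K : ℕ) {m : ℕ} → (Fin m → Cell n) → Fin n → Fin n → Set
  Separated {n} adj K Cs x y = x ≢ y × (∀ j → n ≤ K * dist (Cs j) (adj x) (adj y))

  -- Cutting each of m cells by a set N gives 2m cells, indexed by Fin (m + m):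
  -- the first m are the parts inside N, the last m the parts outside.

  unpair : {m : ℕ} → Fin (m + m) → Fin m × Bool
  unpair {m} i = [ (_, true) , (_, false) ]′ (splitAt m i)

  pairUp : {m : ℕ} → Fin m → Bool → Fin (m + m)
  pairUp {m} j true  = j ↑ˡ m
  pairUp {m} j false = m ↑ʳ j

  unpair-pairUp : {m : ℕ} (j : Fin m) (σ : Bool) → unpair {m} (pairUp j σ) ≡ (j , σ)
  unpair-pairUp {m} j true  rewrite splitAt-↑ˡ m j m = refl
  unpair-pairUp {m} j false rewrite splitAt-↑ʳ m m j = refl

  halves : {m : ℕ} → (Fin m → Cell n) → Cell n → Fin (m + m) → Cell n
  halves {m = m} Cs N i = side (proj₂ (unpair {m} i)) (Cs (proj₁ (unpair {m} i))) N

  halves-pairUp : {m : ℕ} (Cs : Fin m → Cell n) (N : Cell n) (j : Fin m) (σ : Bool) →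
                  halves Cs N (pairUp j σ) ≡ side σ (Cs j) N
  halves-pairUp {m = m} Cs N j σ rewrite unpair-pairUp {m} j σ = refl

  cutAt : {m : ℕ} → (Fin m → Cell n) → Fin m → Bool → Cell n → Fin m → Cell n
  cutAt Cs k σ N = updateAt Cs k (λ C → side σ C N)

  cutAt-⊆ : {m : ℕ} (Cs : Fin m → Cell n) (k : Fin m) (σ : Bool) (N : Cell n) → ∀ j → cutAt Cs k σ N j ⊆ᶜ Cs j
  cutAt-⊆ Cs k σ N j with j ≟ k
  ... | yes refl rewrite updateAt-updates j {λ C → side σ C N} Cs = side-⊆ σ (Cs j) N
  ... | no j≢k   rewrite updateAt-minimal j k {λ C → side σ C N} Cs j≢k = λ v h → h

  ∑-cutAt : {m : ℕ} (Cs : Fin m → Cell n) (k : Fin m) (σ : Bool) (N : Cell n) →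
            ∑ (count ∘ cutAt Cs k (not σ) N) + count (side σ (Cs k) N) ≡ ∑ (count ∘ Cs)
  ∑-cutAt Cs k σ N = +-cancelʳ-≡ (count (side (not σ) (Cs k) N)) _ _ (begin
    ∑ (count ∘ cutAt Cs k (not σ) N) + count (side σ (Cs k) N) + count (side (not σ) (Cs k) N)
      ≡⟨ +-assoc (∑ (count ∘ cutAt Cs k (not σ) N)) _ _ ⟩
    ∑ (count ∘ cutAt Cs k (not σ) N) + (count (side σ (Cs k) N) + count (side (not σ) (Cs k) N))
      ≡⟨ cong (∑ (count ∘ cutAt Cs k (not σ) N) +_) (count-split σ (Cs k) N) ⟨
    ∑ (count ∘ cutAt Cs k (not σ) N) + count (Cs k)
      ≡⟨ ∑-updateAt count Cs k (λ C → side (not σ) C N) ⟩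
    ∑ (count ∘ Cs) + count (side (not σ) (Cs k) N) ∎)
    where open ≡-Reasoning



  -- Arithmetic of the refinement step, stated for arbitrary numbers: k stands
  -- for the separation constant, Q for the number of rounds, M = 4kQ for the
  -- refined separation constant and 2kn for the erosion caused by one round.

  -- Two points whose σ-sides of a cell are both smaller than n / 4k differ in
  -- fewer than n / 2k vertices of it, which is less than what q ≤ Q rounds of
  -- erosion leave of the separation n / k.
  small-sides-exclusive : ∀ k Q q n {a c e} .{{_ : NonZero k}} .{{_ : NonZero Q}} → q ≤ Q →
                          e ≤ a + c → 4 * k * a < n → 4 * k * c < n →
                          4 * k * Q * n ≤ k * (4 * k * Q) * e + q * (2 * k * n) → ⊥
  small-sides-exclusive k Q q n {a} {c} {e} q≤Q e≤a+c small-a small-c intact = <-irrefl refl (begin-strict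
    M * n + M * n                         ≡⟨ double (M * n) ⟩
    2 * (M * n)                           ≤⟨ *-monoʳ-≤ 2 intact ⟩
    2 * (k * M * e + q * (2 * k * n))     ≡⟨ regroup k M e (q * (2 * k * n)) ⟩
    M * (2 * k * e) + 2 * (q * (2 * k * n)) <⟨ +-mono-<-≤ (*-monoʳ-< M close) bounded-loss ⟩
    M * n + M * n                         ∎)
    where
    open ≤-Reasoning
    M = 4 * k * Q
    instance
      M≢0 : NonZero M
      M≢0 = m*n≢0 (4 * k) Q {{m*n≢0 4 k}}
    double : ∀ a → a + a ≡ 2 * a
    double = solve-∀
    regroup : ∀ k a b c → 2 * (k * a * b + c) ≡ a * (2 * k * b) + 2 * c
    regroup = solve-∀
    double-twice : ∀ k e → 2 * (2 * k * e) ≡ 4 * k * e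
    double-twice = solve-∀
    regroup-loss : ∀ q k n → 2 * (q * (2 * k * n)) ≡ q * (4 * k * n)
    regroup-loss = solve-∀
    regroup-M : ∀ Q k n → Q * (4 * k * n) ≡ 4 * k * Q * n
    regroup-M = solve-∀
    close : 2 * k * e < n
    close = *-cancelˡ-< 2 _ _ (begin-strict
      2 * (2 * k * e)       ≡⟨ double-twice k e ⟩
      4 * k * e             ≤⟨ *-monoʳ-≤ (4 * k) e≤a+c ⟩
      4 * k * (a + c)       ≡⟨ *-distribˡ-+ (4 * k) a c ⟩
      4 * k * a + 4 * k * c <⟨ +-mono-< small-a small-c ⟩
      n + n                 ≡⟨ double n ⟩
      2 * n                 ∎)
    bounded-loss : 2 * (q * (2 * k * n)) ≤ M * n
    bounded-loss = begin
      2 * (q * (2 * k * n)) ≡⟨ regroup-loss q k n ⟩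
      q * (4 * k * n)       ≤⟨ *-monoˡ-≤ (4 * k * n) q≤Q ⟩
      Q * (4 * k * n)       ≡⟨ regroup-M Q k n ⟩
      M * n                 ∎

  -- Replacing a cell by the half on which it has distance e, the other half
  -- contributing at most 2n / M, costs one more unit 2kn of erosion.
  eroded : ∀ k M q n {c e} → M * n ≤ k * M * (c + e) + q * (2 * k * n) → M * c ≤ n + n →
           M * n ≤ k * M * e + suc q * (2 * k * n)
  eroded k M q n {c} {e} intact close = begin
    M * n                                       ≤⟨ intact ⟩
    k * M * (c + e) + q * (2 * k * n)           ≡⟨ cong (_+ q * (2 * k * n)) (*-distribˡ-+ (k * M) c e) ⟩
    k * M * c + k * M * e + q * (2 * k * n)     ≡⟨ cong (λ x → x + k * M * e + q * (2 * k * n)) (*-assoc k M c) ⟩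
    k * (M * c) + k * M * e + q * (2 * k * n)   ≤⟨ +-monoˡ-≤ _ (+-monoˡ-≤ _ (*-monoʳ-≤ k close)) ⟩
    k * (n + n) + k * M * e + q * (2 * k * n)   ≡⟨ cong (λ x → x + k * M * e + q * (2 * k * n)) (double-k k n) ⟩
    2 * k * n + k * M * e + q * (2 * k * n)     ≡⟨ cong (_+ q * (2 * k * n)) (+-comm (2 * k * n) (k * M * e)) ⟩
    k * M * e + 2 * k * n + q * (2 * k * n)     ≡⟨ +-assoc (k * M * e) (2 * k * n) (q * (2 * k * n)) ⟩
    k * M * e + suc q * (2 * k * n)             ∎
    where
    open ≤-Reasoning
    double-k : ∀ k n → k * (n + n) ≡ 2 * k * n
    double-k = solve-∀

  -- Cells that are not replaced only weaken the bound by one unit.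
  eroded-unchanged : ∀ q l {x y} → x ≤ y + q * l → x ≤ y + suc q * l
  eroded-unchanged q l le = ≤-trans le (+-monoʳ-≤ _ (m≤n+m (q * l) l))

  -- Separation n / k is the initial state, before any erosion.
  separated⇒intact : ∀ k M n {l e} → n ≤ k * e → M * n ≤ k * M * e + 0 * l
  separated⇒intact k M n {l} {e} far = begin
    M * n           ≤⟨ *-monoʳ-≤ M far ⟩
    M * (k * e)     ≡⟨ reorder k M e l ⟩
    k * M * e + 0 * l ∎
    where
    open ≤-Reasoning
    reorder : ∀ k M e l → M * (k * e) ≡ k * M * e + 0 * l
    reorder = solve-∀

  -- Removing a part of size c ≥ n / F from cells of total size S pays for one
  -- more unit n of the potential.
  potential-drops : ∀ F q n {S S′ c P} → F * S + q * n ≤ P → S′ + c ≡ S → n ≤ F * c →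
                    F * S′ + suc q * n ≤ P
  potential-drops F q n {S} {S′} {c} {P} potential S′+c≡S large = begin
    F * S′ + suc q * n        ≡⟨ +-assoc (F * S′) n (q * n) ⟨
    F * S′ + n + q * n        ≤⟨ +-monoˡ-≤ (q * n) (+-monoʳ-≤ (F * S′) large) ⟩
    F * S′ + F * c + q * n    ≡⟨ cong (_+ q * n) (*-distribˡ-+ F S′ c) ⟨
    F * (S′ + c) + q * n      ≡⟨ cong (λ s → F * s + q * n) S′+c≡S ⟩
    F * S + q * n             ≤⟨ potential ⟩
    P                         ∎
    where open ≤-Reasoning

  -- After F m + 1 units have been paid, nothing can be left.
  potential-exhausted : ∀ F m n S → F * S + suc (F * m) * n ≤ F * m * n → n ≡ 0
  potential-exhausted F m n S potential = n≤0⇒n≡0 (+-cancelʳ-≤ (F * m * n) n 0 (begin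
    n + F * m * n             ≡⟨ unfold n F m ⟩
    suc (F * m) * n           ≤⟨ m≤n+m _ (F * S) ⟩
    F * S + suc (F * m) * n   ≤⟨ potential ⟩
    F * m * n                 ∎))
    where
    open ≤-Reasoning
    unfold : ∀ n F m → n + F * m * n ≡ suc (F * m) * n
    unfold = solve-∀

  -- Parameters of the refinement step for m cells and separation constant K + 1:
  -- at most 'rounds m K' shrinking rounds, after which points are separated by
  -- all 2m halves with the constant 'refinedSeparation m K'.

  rounds : ℕ → ℕ → ℕ
  rounds m K = suc (4 * suc K * m)

  refinedSeparation : ℕ → ℕ → ℕ
  refinedSeparation m K = 4 * suc K * rounds m K

  -- Number of points needed to run f more rounds and keep T points at the end.
  required : ℕ → ℕ → ℕ → ℕ
  required m zero    T = 1
  required m (suc f) T = (m + m) + suc ((T + required m f T) ^ suc (m + m))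

  -- Given points pairwise
  -- separated by m cells, we look for a pivot b and many further points that are
  -- separated by every half of every cell cut by Γ(b).  In each round we first
  -- discard the at most 2m points one of whose halves is small, take the next
  -- point b as pivot candidate, and cluster the rest with respect to every half.
  -- Either all points are pairwise far in every half (success), or a large
  -- cluster is close in one half C ∩ Γ(b)^σ; then we replace the cell C by its
  -- other half, on which the cluster stays separated up to a small erosion, and
  -- start a new round.  Each replacement removes at least n / 4(K+1) vertices
  -- from the cells, so there are fewer than 'rounds m K' of them.
  module DensityIncrement {n : ℕ} (adj : Fin n → Fin n → Bool) (m K : ℕ) where

    KK Q M loss : ℕ
    KK   = suc K
    Q    = rounds m K
    M    = refinedSeparation m K
    loss = 2 * KK * n

    Cells : Set
    Cells = Fin m → Cell n

    d : Cell n → Fin n → Fin n → ℕ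
    d C x y = dist C (adj x) (adj y)

    -- After q rounds x and y are separated by every cell up to an erosion q · loss
    -- (in units of 1 / KK M: separation n / KK minus q · 2n / M).
    Intact : ℕ → Cells → Fin n → Fin n → Set
    Intact q Cs x y = x ≢ y × (∀ j → M * n ≤ KK * M * d (Cs j) x y + q * loss)

    -- Each round removes at least n / 4KK vertices from cells of total size at most m n.
    Potential : ℕ → Cells → Set
    Potential q Cs = 4 * KK * ∑ (count ∘ Cs) + q * n ≤ 4 * KK * m * n

    potential-initially : (Cs : Cells) → Potential 0 Cs
    potential-initially Cs = begin
      4 * KK * ∑ (count ∘ Cs) + 0 * n ≡⟨ +-identityʳ _ ⟩
      4 * KK * ∑ (count ∘ Cs)         ≤⟨ *-monoʳ-≤ (4 * KK) (∑-≤-const (count ∘ Cs) n (count≤n ∘ Cs)) ⟩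
      4 * KK * (m * n)                ≡⟨ *-assoc (4 * KK) m n ⟨
      4 * KK * m * n                  ∎
      where open ≤-Reasoning

    Small : Cells → Fin (m + m) → Fin n → Set
    Small Cs i x = 4 * KK * count (halves Cs (adj x) i) < n

    small-exclusive : ∀ q → q ≤ Q → (Cs : Cells) {x y : Fin n} → Intact q Cs x y →
                      ∀ i → Small Cs i x → Small Cs i y → ⊥
    small-exclusive q q≤Q Cs {x} {y} (_ , intact) i small-x small-y =
      small-sides-exclusive KK Q q n q≤Q (dist-≤-sides σ (Cs j) (adj x) (adj y)) small-x small-y (intact j)
      where
      j = proj₁ (unpair {m} i)
      σ = proj₂ (unpair {m} i)

    near-via-centre : (C : Cell n) {x y z : Fin n} → M * d C x y < n → M * d C x z < n → M * d C y z ≤ n + n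
    near-via-centre C {x} {y} {z} close-y close-z = begin
      M * d C y z               ≤⟨ *-monoʳ-≤ M (dist-triangle C (adj y) (adj x) (adj z)) ⟩
      M * (d C y x + d C x z)   ≡⟨ *-distribˡ-+ M (d C y x) (d C x z) ⟩
      M * d C y x + M * d C x z ≡⟨ cong (λ e → M * e + M * d C x z) (dist-sym C (adj y) (adj x)) ⟩
      M * d C x y + M * d C x z ≤⟨ +-mono-≤ (<⇒≤ close-y) (<⇒≤ close-z) ⟩
      n + n                     ∎
      where open ≤-Reasoning

    record Pivot (Cs : Cells) (G : List (Fin n)) (T : ℕ) : Set where
      constructor pivotWith
      field
        pivot   : Fin n
        rest    : List (Fin n)
        ⊑G      : pivot ∷ rest ⊑ G
        size    : T ≤ length rest
        shrunk  : Cells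
        shrunk⊆ : ∀ j → shrunk j ⊆ᶜ Cs j
        fresh   : All (pivot ≢_) rest
        spread  : AllPairs (Separated adj M (halves shrunk (adj pivot))) rest

    pivot-mono : ∀ {Cs Cs′ G G′ T T′} → T ≤ T′ → (∀ j → Cs′ j ⊆ᶜ Cs j) → G′ ⊑ G →
                 Pivot Cs′ G′ T′ → Pivot Cs G T
    pivot-mono T≤T′ Cs′⊆Cs G′⊑G (pivotWith b H bH⊑G′ size shrunk shrunk⊆ fresh spread) =
      pivotWith b H (⊆-trans bH⊑G′ G′⊑G) (≤-trans T≤T′ size) shrunk
                (λ j v → Cs′⊆Cs j v ∘ shrunk⊆ j v) fresh spread

    record Shrinking (q : ℕ) (Cs : Cells) (G : List (Fin n)) (T : ℕ) : Set where
      constructor shrinkTo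
      field
        cells     : Cells
        cells⊆    : ∀ j → cells j ⊆ᶜ Cs j
        potential : Potential (suc q) cells
        points    : Clique (Intact (suc q) cells) T G

    Close Near : Cells → Fin n → Fin (m + m) → Fin n → Fin n → Set
    Close Cs b i x y = M * d (halves Cs (adj b) i) x y < n
    Near  Cs b i x y = M * d (halves Cs (adj b) i) x y ≤ n + n

    far-clique⇒pivot : ∀ {q Cs G T} (b : Fin n) (H : List (Fin n)) → b ∷ H ⊑ G →
                       AllPairs (Intact q Cs) (b ∷ H) → Clique (λ x y → ∀ i → ¬ Close Cs b i x y) T H →
                       Pivot Cs G T
    far-clique⇒pivot {q} {Cs} b H bH⊑G (intact-b ∷ intact) (clique H′ H′⊑H size far) =
      pivotWith b H′ (⊆-trans (refl ∷ H′⊑H) bH⊑G) size Cs (λ j v h → h)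
                (All.map proj₁ (All-resp-⊆ H′⊑H intact-b))
                (AllPairs.zipWith separated (AllPairs-resp-⊑ H′⊑H intact , far))
      where
      separated : ∀ {x y} → Intact q Cs x y × (∀ i → ¬ Close Cs b i x y) → Separated adj M (halves Cs (adj b)) x y
      separated ((x≢y , _) , far) = x≢y , λ i → ≮⇒≥ (far i)

    -- If a T-clique is near in the half i = (k, σ) of the cells cut by Γ(b), and
    -- that half is large, replace the cell k by its other half: the clique stays
    -- intact with one more unit of erosion and one unit of potential is paid.
    near-clique⇒shrinking : ∀ {q Cs G T} → Potential q Cs → (b : Fin n) (H : List (Fin n)) → H ⊑ G →
                            AllPairs (Intact q Cs) H → (i : Fin (m + m)) → ¬ Small Cs i b →
                            Clique (Near Cs b i) T H → Shrinking q Cs G T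
    near-clique⇒shrinking {q} {Cs} potential b H H⊑G intact i large (clique Z Z⊑H size near) =
      shrinkTo cells (cutAt-⊆ Cs k (not σ) (adj b))
               (potential-drops (4 * KK) q n potential (∑-cutAt Cs k σ (adj b)) (≮⇒≥ large))
               (clique Z (⊆-trans Z⊑H H⊑G) size (AllPairs.zipWith still-intact (AllPairs-resp-⊑ Z⊑H intact , near)))
      where
      k = proj₁ (unpair {m} i)
      σ = proj₂ (unpair {m} i)
      cells : Cells
      cells = cutAt Cs k (not σ) (adj b)

      -- on the new cell k the pair loses at most its distance in the removed half
      still-intact : ∀ {x y} → Intact q Cs x y × Near Cs b i x y → Intact (suc q) cells x y
      still-intact {x} {y} ((x≢y , intact) , close) = x≢y , intact′
        where
        intact′ : ∀ j → M * n ≤ KK * M * d (cells j) x y + suc q * loss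
        intact′ j with j ≟ k
        ... | yes refl rewrite updateAt-updates j {λ C → side (not σ) C (adj b)} Cs =
              eroded KK M q n (subst (λ e → M * n ≤ KK * M * e + q * loss)
                                     (dist-split σ (Cs j) (adj b) (adj x) (adj y)) (intact j)) close
        ... | no j≢k rewrite updateAt-minimal j k {λ C → side (not σ) C (adj b)} Cs j≢k =
              eroded-unchanged q loss (intact j)

    round : ∀ q → q < Q → (Cs : Cells) → Potential q Cs → (G : List (Fin n)) → AllPairs (Intact q Cs) G →
            (T : ℕ) → (m + m) + suc (T ^ suc (m + m)) ≤ length G → Pivot Cs G T ⊎ Shrinking q Cs G T
    round q q<Q Cs potential G intact T size
      with discard (m + m) (λ i x → 4 * KK * count (halves Cs (adj x) i) <? n)
                   (small-exclusive q (<⇒≤ q<Q) Cs) G intact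
    ... | [] , _ , few , _ = ⊥-elim (n≮0 (+-cancelˡ-≤ (m + m) _ 0 (≤-trans size few)))
    ... | b ∷ H , bH⊑G , few , b-large ∷ _
      with multiCluster (m + m) (λ i x y → M * d (halves Cs (adj b) i) x y <? n)
                        (λ i close → ≤-trans (<⇒≤ close) (m≤m+n n n)) (λ i → near-via-centre (halves Cs (adj b) i))
                        T H (≤-pred (+-cancelˡ-≤ (m + m) _ _ (≤-trans size few)))
    ...   | inj₁ far        = inj₁ (far-clique⇒pivot {q} b H bH⊑G (AllPairs-resp-⊑ bH⊑G intact) far)
    ...   | inj₂ (i , near) = inj₂ (near-clique⇒shrinking potential b H (∷ˡ⁻ bH⊑G)
                                      (AllPairs.tail (AllPairs-resp-⊑ bH⊑G intact)) i (b-large i) near)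

    -- Running the rounds, with fuel f = Q - q; the potential rules out reaching q = Q.
    rounds-loop : ∀ f q → q + f ≡ Q → (T : ℕ) (Cs : Cells) → Potential q Cs → (G : List (Fin n)) →
                  AllPairs (Intact q Cs) G → required m f T ≤ length G → Pivot Cs G T
    rounds-loop zero q q≡Q T Cs potential [] _ ()
    rounds-loop zero q q≡Q T Cs potential (x ∷ G) _ _ = ⊥-elim (¬Fin0 (subst Fin n≡0 x))
      where
      n≡0 : n ≡ 0
      n≡0 = potential-exhausted (4 * KK) m n (∑ (count ∘ Cs))
              (subst (λ q → Potential q Cs) (trans (sym (+-identityʳ q)) q≡Q) potential)
    rounds-loop (suc f) q q+f≡Q T Cs potential G intact size
      with round q q<Q Cs potential G intact (T + required m f T) size
      where
      q<Q : q < Q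
      q<Q = ≤-trans (s≤s (m≤m+n q f)) (≤-reflexive (trans (sym (+-suc q f)) q+f≡Q))
    ... | inj₁ pivot = pivot-mono (m≤m+n T _) (λ _ _ h → h) ⊆-refl pivot
    ... | inj₂ (shrinkTo cells cells⊆ potential′ (clique G′ G′⊑G size′ intact′)) =
          pivot-mono ≤-refl cells⊆ G′⊑G
            (rounds-loop f (suc q) (trans (sym (+-suc q f)) q+f≡Q) T cells potential′ G′ intact′
                         (≤-trans (m≤n+m _ T) size′))

    pivot-exists : (Cs : Cells) (T : ℕ) (bs : List (Fin n)) → required m Q T ≤ length bs →
                   AllPairs (Separated adj KK Cs) bs → Pivot Cs bs T
    pivot-exists Cs T bs size separated =
      rounds-loop Q 0 refl T Cs (potential-initially Cs) bs (AllPairs.map intact-initially separated) size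
      where
      intact-initially : ∀ {x y} → Separated adj KK Cs x y → Intact 0 Cs x y
      intact-initially (x≢y , far) = x≢y , λ j → separated⇒intact KK M n {loss} (far j)

  -- Pattern cells.  For chosen vertices β₁, …, β_t and a pattern p ∈ {0,1}^t,
  -- cell adj C β p = { v ∈ C : v ∈ Γ(β i) ⇔ p i for all i }.

  cell : (adj : Fin n → Fin n → Bool) {t : ℕ} → Cell n → (Fin t → Fin n) → (Fin t → Bool) → Cell n
  cell adj {zero}  C β p = C
  cell adj {suc t} C β p = cell adj (side (p zero) C (adj (β zero))) (β ∘ suc) (p ∘ suc)

  cell-mono : (adj : Fin n → Fin n → Bool) {t : ℕ} {C D : Cell n} (β : Fin t → Fin n) (p : Fin t → Bool) →
              C ⊆ᶜ D → cell adj C β p ⊆ᶜ cell adj D β p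
  cell-mono adj {zero}  β p C⊆D = C⊆D
  cell-mono adj {suc t} β p C⊆D = cell-mono adj (β ∘ suc) (p ∘ suc) (side-mono (p zero) (adj (β zero)) C⊆D)

  cell-⊆ : (adj : Fin n → Fin n → Bool) {t : ℕ} (C : Cell n) (β : Fin t → Fin n) (p : Fin t → Bool) →
           cell adj C β p ⊆ᶜ C
  cell-⊆ adj {zero}  C β p = λ v h → h
  cell-⊆ adj {suc t} C β p v h =
    side-⊆ (p zero) C (adj (β zero)) v (cell-⊆ adj (side (p zero) C (adj (β zero))) (β ∘ suc) (p ∘ suc) v h)

  cell-pattern : (adj : Fin n → Fin n → Bool) {t : ℕ} (C : Cell n) (β : Fin t → Fin n) (p : Fin t → Bool) →
                 ∀ v → cell adj C β p v ≡ true → ∀ i → adj (β i) v ≡ p i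
  cell-pattern adj {suc t} C β p v h zero =
    agreement (p zero) (C v) (adj (β zero) v) (cell-⊆ adj (side (p zero) C (adj (β zero))) (β ∘ suc) (p ∘ suc) v h)
    where
    agreement : ∀ σ c a → c ∧ agree σ a ≡ true → a ≡ σ
    agreement true  true true  _ = refl
    agreement false true false _ = refl
  cell-pattern adj {suc t} C β p v h (suc i) =
    cell-pattern adj (side (p zero) C (adj (β zero))) (β ∘ suc) (p ∘ suc) v h i

  record Selection (adj : Fin n → Fin n → Bool) {m : ℕ} (Cs : Fin m → Cell n) (bs : List (Fin n)) (t D : ℕ) : Set where
    constructor selected
    field
      chosen    : Fin t → Fin n
      chosen∈   : ∀ i → chosen i ∈ˡ bs
      injective : ∀ {i i′} → chosen i ≡ chosen i′ → i ≡ i′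
      large     : ∀ j p → n ≤ D * count (cell adj (Cs j) chosen p)

  -- A pivot b in front of a selection for the halves of smaller cells cut by
  -- Γ(b) is a selection for the original cells: the pattern cell of p in C
  -- contains the pattern cell of p without its first bit in the half of C
  -- selected by that bit.
  extend : {adj : Fin n → Fin n → Bool} {m t D : ℕ} {Cs Cs′ : Fin m → Cell n} {bs H : List (Fin n)}
           (b : Fin n) → b ∷ H ⊑ bs → All (b ≢_) H → (∀ j → Cs′ j ⊆ᶜ Cs j) →
           Selection adj (halves Cs′ (adj b)) H t D → Selection adj Cs bs (suc t) D
  extend {n} {adj} {m} {t} {D} {Cs} {Cs′} {bs} b bH⊑bs fresh Cs′⊆Cs (selected β β∈H injective large) =
    selected (b Vector.∷ β) chosen∈ injective′ large′
    where
    chosen∈ : ∀ i → (b Vector.∷ β) i ∈ˡ bs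
    chosen∈ zero    = Sublist.lookup bH⊑bs (here refl)
    chosen∈ (suc i) = Sublist.lookup bH⊑bs (there (β∈H i))

    injective′ : ∀ {i i′} → (b Vector.∷ β) i ≡ (b Vector.∷ β) i′ → i ≡ i′
    injective′ {zero}  {zero}   _  = refl
    injective′ {zero}  {suc i′} eq = ⊥-elim (All.lookup fresh (β∈H i′) eq)
    injective′ {suc i} {zero}   eq = ⊥-elim (All.lookup fresh (β∈H i) (sym eq))
    injective′ {suc i} {suc i′} eq = cong suc (injective eq)

    large′ : ∀ j p → n ≤ D * count (cell adj (Cs j) (b Vector.∷ β) p)
    large′ j p = ≤-trans (large (pairUp j (p zero)) (p ∘ suc))
                         (*-monoʳ-≤ D (count-mono (cell-mono adj β (p ∘ suc) half⊆side)))
      where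
      half⊆side : halves Cs′ (adj b) (pairUp j (p zero)) ⊆ᶜ side (p zero) (Cs j) (adj b)
      half⊆side = subst (_⊆ᶜ side (p zero) (Cs j) (adj b)) (sym (halves-pairUp Cs′ (adj b) j (p zero)))
                        (side-mono (p zero) (adj b) (Cs′⊆Cs j))

  Selectable : ℕ → ℕ → ℕ → ℕ → ℕ → Set
  Selectable t m K N D = ∀ {n} (adj : Fin n → Fin n → Bool) (Cs : Fin m → Cell n) (bs : List (Fin n)) →
                         N ≤ length bs → AllPairs (Separated adj K Cs) bs → Selection adj Cs bs t D

  -- For t = 0 the single (empty)
  -- pattern cell is a whole cell, which is large because two separated points
  -- differ in n / K of its vertices.  For t + 1 the refinement step provides a
  -- pivot and points separated by the 2m halves, and induction selects t of them.
  selection : ∀ t m K → ∃[ N ] ∃[ D ] Selectable t m K N D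
  selection zero m K = 2 , K , empty-selection
    where
    empty-selection : Selectable zero m K 2 K
    empty-selection adj Cs []          ()        _
    empty-selection adj Cs (x ∷ [])    (s≤s ())  _
    empty-selection adj Cs (x ∷ y ∷ _) _ ((separated-xy ∷ _) ∷ _) =
      selected (λ ()) (λ ()) (λ {i} → case i of λ ())
               (λ j p → ≤-trans (proj₂ separated-xy j) (*-monoʳ-≤ K (dist≤count (Cs j) (adj x) (adj y))))
  selection (suc t) m K with selection t (m + m) (refinedSeparation m K)
  ... | N , D , select = required m (rounds m K) N , D , select-more
    where
    select-more : Selectable (suc t) m K (required m (rounds m K) N) D
    select-more adj Cs bs size separated
      with DensityIncrement.pivot-exists adj m K Cs N bs size (AllPairs.map weaken separated)
      where
      weaken : ∀ {x y} → Separated adj K Cs x y → Separated adj (suc K) Cs x y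
      weaken (x≢y , far) = x≢y , λ j → ≤-trans (far j) (*-monoˡ-≤ _ (n≤1+n K))
    ... | DensityIncrement.pivotWith b H bH⊑bs size′ shrunk shrunk⊆ fresh spread =
          extend b bH⊑bs fresh shrunk⊆ (select adj (halves shrunk (adj b)) H size′ spread)

  lookup-ext : {X Y : Subset n} → (∀ v → lookup X v ≡ lookup Y v) → X ≡ Y
  lookup-ext {X = X} {Y} same = trans (sym (tabulate∘lookup X)) (trans (tabulate-cong same) (tabulate∘lookup Y))

  ∈-tabulate⁺ : {f : Cell n} {v : Fin n} → f v ≡ true → v ∈ tabulate f
  ∈-tabulate⁺ {f = f} {v} fv = lookup⇒[]= v (tabulate f) (trans (lookup∘tabulate f v) fv)

  ∈-tabulate⁻ : {f : Cell n} {v : Fin n} → v ∈ tabulate f → f v ≡ true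
  ∈-tabulate⁻ {f = f} {v} v∈ = trans (sym (lookup∘tabulate f v)) ([]=⇒lookup v∈)

  ∣∣≡count : (X : Subset n) → ∣ X ∣ ≡ count (lookup X)
  ∣∣≡count []          = refl
  ∣∣≡count (true ∷ X)  = cong suc (∣∣≡count X)
  ∣∣≡count (false ∷ X) = ∣∣≡count X

  ∣tabulate∣ : (C : Cell n) → ∣ tabulate C ∣ ≡ count C
  ∣tabulate∣ C = trans (∣∣≡count (tabulate C)) (count-cong (lookup∘tabulate C))

  lookup-△ : (X Y S : Subset n) (v : Fin n) → lookup ((X ∩ S) △ (Y ∩ S)) v ≡ lookup S v ∧ (lookup X v xor lookup Y v)
  lookup-△ (x ∷ X) (y ∷ Y) (s ∷ S) (suc v) = lookup-△ X Y S v
  lookup-△ (true  ∷ X) (true  ∷ Y) (true  ∷ S) zero = refl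
  lookup-△ (true  ∷ X) (false ∷ Y) (true  ∷ S) zero = refl
  lookup-△ (false ∷ X) (true  ∷ Y) (true  ∷ S) zero = refl
  lookup-△ (false ∷ X) (false ∷ Y) (true  ∷ S) zero = refl
  lookup-△ (true  ∷ X) (true  ∷ Y) (false ∷ S) zero = refl
  lookup-△ (true  ∷ X) (false ∷ Y) (false ∷ S) zero = refl
  lookup-△ (false ∷ X) (true  ∷ Y) (false ∷ S) zero = refl
  lookup-△ (false ∷ X) (false ∷ Y) (false ∷ S) zero = refl

  elements : Subset n → List (Fin n)
  elements []          = []
  elements (true ∷ X)  = zero ∷ List.map suc (elements X)
  elements (false ∷ X) = List.map suc (elements X)

  length-elements : (X : Subset n) → length (elements X) ≡ ∣ X ∣
  length-elements []          = refl
  length-elements (true ∷ X)  = cong suc (trans (length-map suc (elements X)) (length-elements X))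
  length-elements (false ∷ X) = trans (length-map suc (elements X)) (length-elements X)

  elements⊆ : (X : Subset n) → All (_∈ X) (elements X)
  elements⊆ []          = []
  elements⊆ (true ∷ X)  = here ∷ All-map⁺ (All.map there (elements⊆ X))
  elements⊆ (false ∷ X) = All-map⁺ (All.map there (elements⊆ X))

  elements-distinct : (X : Subset n) → AllPairs _≢_ (elements X)
  elements-distinct []          = []
  elements-distinct (true ∷ X)  =
    All-map⁺ (All.universal (λ _ ()) (elements X)) ∷ AllPairs-map⁺ (AllPairs.map (_∘ suc-injective) (elements-distinct X))
  elements-distinct (false ∷ X) = AllPairs-map⁺ (AllPairs.map (_∘ suc-injective) (elements-distinct X))

  ∈-image : {m : ℕ} (w : Fin m → Fin n) (j : Fin m) → w j ∈ image w
  ∈-image w j = ∈-tabulate⁺ (found (any? (λ j′ → w j′ ≟ w j)))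
    where
    found : (found? : Dec (∃[ j′ ] w j′ ≡ w j)) → ⌊ found? ⌋ ≡ true
    found (yes _)   = refl
    found (no none) = ⊥-elim (none (j , refl))

  ∈-image⁻ : {m : ℕ} (w : Fin m → Fin n) {v : Fin n} → v ∈ image w → ∃[ j ] w j ≡ v
  ∈-image⁻ w {v} v∈image = witness (any? (λ j → w j ≟ v)) (∈-tabulate⁻ v∈image)
    where
    witness : (found? : Dec (∃[ j ] w j ≡ v)) → ⌊ found? ⌋ ≡ true → ∃[ j ] w j ≡ v
    witness (yes found) _ = found

  count-none : (C : Cell n) → (∀ v → C v ≡ false) → count C ≡ 0
  count-none {zero}  C none = refl
  count-none {suc n} C none rewrite none zero = count-none (C ∘ suc) (none ∘ suc)

  count-singleton : (x : Fin n) → count (λ v → ⌊ x ≟ v ⌋) ≡ 1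
  count-singleton {suc n} zero = cong suc (count-none {n} (λ v → ⌊ zero ≟ suc v ⌋) (λ v → refl))
  count-singleton {suc n} (suc x) = trans (count-cong shift) (count-singleton x)
    where
    shift : ∀ v → ⌊ suc x ≟ suc v ⌋ ≡ ⌊ x ≟ v ⌋
    shift v with x ≟ v
    ... | yes _ = refl
    ... | no  _ = refl

  -- An injective map hits exactly m vertices: its image is the disjoint union
  -- of the singleton {w 0} and the image of the remaining values.
  ∣image∣ : {n m : ℕ} (w : Fin m → Fin n) → (∀ {i j} → w i ≡ w j → i ≡ j) → ∣ image w ∣ ≡ m
  ∣image∣ {n} w injective = trans (∣tabulate∣ {n} _) (count-image w injective)
    where
    count-image : {m : ℕ} (w : Fin m → Fin n) → (∀ {i j} → w i ≡ w j → i ≡ j) →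
                  count (λ v → ⌊ any? (λ j → w j ≟ v) ⌋) ≡ m
    count-image {m = zero}  w injective = count-none {n} _ (λ v → refl)
    count-image {m = suc m} w injective =
      trans (count-partition union disjoint)
            (cong₂ _+_ (count-singleton (w zero)) (count-image (w ∘ suc) (suc-injective ∘ injective)))
      where
      union : ∀ v → ⌊ any? (λ j → w j ≟ v) ⌋ ≡ ⌊ w zero ≟ v ⌋ ∨ ⌊ any? (λ j → w (suc j) ≟ v) ⌋
      union v with w zero ≟ v | any? (λ j → w (suc j) ≟ v)
      ... | yes _ | _     = refl
      ... | no  _ | yes _ = refl
      ... | no  _ | no  _ = refl
      disjoint : ∀ v → ⌊ w zero ≟ v ⌋ ∧ ⌊ any? (λ j → w (suc j) ≟ v) ⌋ ≡ false
      disjoint v with w zero ≟ v | any? (λ j → w (suc j) ≟ v)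
      ... | no  _    | _              = refl
      ... | yes _    | no  _          = ∧-zeroʳ true
      ... | yes refl | yes (j , same) = case injective (sym same) of λ ()

  trace-on-image : {t : ℕ} (β : Fin t → Fin n) {X Y : Subset n} →
                   (∀ k → lookup X (β k) ≡ lookup Y (β k)) → X ∩ image β ≡ Y ∩ image β
  trace-on-image β {X} {Y} agree-on-β = lookup-ext pointwise
    where
    pointwise : ∀ v → lookup (X ∩ image β) v ≡ lookup (Y ∩ image β) v
    pointwise v rewrite lookup-zipWith _∧_ v X (image β) | lookup-zipWith _∧_ v Y (image β)
      with lookup (image β) v in v∈?
    ... | false = trans (∧-zeroʳ _) (sym (∧-zeroʳ _))
    ... | true with ∈-image⁻ β (lookup⇒[]= v (image β) v∈?)
    ... | k , refl = cong (_∧ true) (agree-on-β k)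

  ∩-⊆ : {X Y : Subset n} → X ⊆ Y → X ∩ Y ≡ X
  ∩-⊆ {X = X} {Y} X⊆Y = lookup-ext pointwise
    where
    pointwise : ∀ v → lookup (X ∩ Y) v ≡ lookup X v
    pointwise v rewrite lookup-zipWith _∧_ v X Y with lookup X v in v∈X
    ... | false = refl
    ... | true  = []=⇒lookup (X⊆Y (lookup⇒[]= v X v∈X))

  -- Rational bounds.  A positive rational α = p / q satisfies α ≥ 1 / q, so
  -- α n ≤ x gives n ≤ q x; conversely n ≤ (D + 1) x gives n / (D + 1) ≤ x.

  ℕ→ℚᵘ : (k : ℕ) → toℚᵘ (ℕ→ℚ k) ≃ᵘ mkℚᵘ (ℤ.+ k) 0
  ℕ→ℚᵘ k = toℚᵘ-fromℚᵘ (mkℚᵘ (ℤ.+ k) 0)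

  -- For a rational a = p / (q + 1), the inequality a n ≤ x means p n ≤ (q + 1) x.
  module ScaledInequality {a : ℚ} {p q : ℕ} (a≃p/q : toℚᵘ a ≃ᵘ mkℚᵘ (ℤ.+ p) q) (n x : ℕ) where

    product : toℚᵘ (a *ℚ ℕ→ℚ n) ≃ᵘ mkℚᵘ (ℤ.+ p) q *ᵘ mkℚᵘ (ℤ.+ n) 0
    product = ≃ᵘ-trans (toℚᵘ-homo-* a (ℕ→ℚ n)) (*ᵘ-cong a≃p/q (ℕ→ℚᵘ n))

    lhs : (ℤ.+ p ℤ.* ℤ.+ n) ℤ.* ℤ.+ 1 ≡ ℤ.+ (p * n)
    lhs = trans (ℤ*-identityʳ _) (sym (pos-* p n))

    rhs : ℤ.+ x ℤ.* ℤ.+ suc (q * 1) ≡ ℤ.+ (suc q * x)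
    rhs = trans (sym (pos-* x (suc (q * 1)))) (cong ℤ.+_ (trans (cong (λ e → x * suc e) (*-identityʳ q)) (*-comm x (suc q))))

    scaled-≤⁻ : a *ℚ ℕ→ℚ n ≤ℚ ℕ→ℚ x → p * n ≤ suc q * x
    scaled-≤⁻ an≤x with ≤ᵘ-respʳ-≃ᵘ (ℕ→ℚᵘ x) (≤ᵘ-respˡ-≃ᵘ product (toℚᵘ-mono-≤ an≤x))
    ... | *≤* cross = drop‿+≤+ (subst₂ ℤ._≤_ lhs rhs cross)

    scaled-≤⁺ : p * n ≤ suc q * x → a *ℚ ℕ→ℚ n ≤ℚ ℕ→ℚ x
    scaled-≤⁺ pn≤qx = toℚᵘ-cancel-≤ (≤ᵘ-respˡ-≃ᵘ (≃ᵘ-sym product)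
                        (≤ᵘ-respʳ-≃ᵘ (≃ᵘ-sym (ℕ→ℚᵘ x)) (*≤* (subst₂ ℤ._≤_ (sym lhs) (sym rhs) (ℤ.+≤+ pn≤qx)))))

  open ScaledInequality using (scaled-≤⁻; scaled-≤⁺)

  ratio-bound : (α : ℚ) → Positive α → ∃[ E ] (∀ n x → α *ℚ ℕ→ℚ n ≤ℚ ℕ→ℚ x → n ≤ E * x)
  ratio-bound (mkℚ (ℤ.+ suc p) q _) _ =
    suc q , λ n x αn≤x → ≤-trans (m≤n*m n (suc p)) (scaled-≤⁻ ≃ᵘ-refl n x αn≤x)

  -- The rational 1 / (D + 1).
  unitFraction : ℕ → ℚ
  unitFraction D = fromℚᵘ (mkℚᵘ (ℤ.+ 1) D)

  unitFraction-positive : (D : ℕ) → Positive (unitFraction D)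
  unitFraction-positive D = normalize-pos 1 (suc D)

  unitFraction-bound : (D n x : ℕ) → n ≤ suc D * x → unitFraction D *ℚ ℕ→ℚ n ≤ℚ ℕ→ℚ x
  unitFraction-bound D n x n≤Dx =
    scaled-≤⁺ (toℚᵘ-fromℚᵘ (mkℚᵘ (ℤ.+ 1) D)) n x (subst (_≤ suc D * x) (sym (*-identityˡ n)) n≤Dx)

  -- Patterns indexed by Fin (2 ^ t), through Fin (2 ^ t) ≅ (Fin t → Fin 2).

  bit : Fin 2 → Bool
  bit zero       = false
  bit (suc zero) = true

  toBit : Bool → Fin 2
  toBit false = zero
  toBit true  = suc zero

  bits : {t : ℕ} → Fin (2 ^ t) → Fin t → Bool
  bits j = bit ∘ finToFun j

  bits-surjective : {t : ℕ} (p : Fin t → Bool) → ∃[ j ] (∀ k → bits j k ≡ p k)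
  bits-surjective p = funToFin (toBit ∘ p) , λ k → trans (cong bit (finToFun-funToFin (toBit ∘ p) k)) (bit-toBit (p k))
    where
    bit-toBit : ∀ b → bit (toBit b) ≡ b
    bit-toBit false = refl
    bit-toBit true  = refl

  -- The theorem with the densities given by integer constants: n / E for the
  -- separation and n / (D + 1) for the sizes of the sets T i j.
  record Shattered {n r : ℕ} (G : Graph n) (P : Fin n → Fin r) (B : Subset n) (t D : ℕ) : Set where
    field
      B′         : Subset n
      B′⊆B       : B′ ⊆ B
      ∣B′∣≡t      : ∣ B′ ∣ ≡ t
      T          : Fin r → Fin (2 ^ t) → Subset n
      T⊆part     : ∀ i j → T i j ⊆ part P i
      T-large    : ∀ i j → n ≤ suc D * ∣ T i j ∣
      T-uniform  : ∀ i j u v → u ∈ T i j → v ∈ T i j → Γ G u ∩ B′ ≡ Γ G v ∩ B′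
      T-shatters : (w : Fin (2 ^ t) → Fin n) → (∀ j → ∃[ i ] w j ∈ T i j) → Shatters G (image w) B′

  partCell : {r : ℕ} → (Fin n → Fin r) → Fin r → Cell n
  partCell P j v = ⌊ P v ≟ j ⌋

  distance-in-part : {r : ℕ} (G : Graph n) (P : Fin n → Fin r) (j : Fin r) (b b′ : Fin n) →
                     ∣ (Γ G b ∩ part P j) △ (Γ G b′ ∩ part P j) ∣ ≡ dist (partCell P j) (adj G b) (adj G b′)
  distance-in-part G P j b b′ = trans (∣∣≡count ((Γ G b ∩ part P j) △ (Γ G b′ ∩ part P j))) (count-cong pointwise)
    where
    pointwise : ∀ v → lookup ((Γ G b ∩ part P j) △ (Γ G b′ ∩ part P j)) v ≡
                      partCell P j v ∧ (adj G b v xor adj G b′ v)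
    pointwise v rewrite lookup-△ (Γ G b) (Γ G b′) (part P j) v
                      | lookup∘tabulate (partCell P j) v | lookup∘tabulate (adj G b) v | lookup∘tabulate (adj G b′) v = refl

  -- A selection of t points in B for the cells S_1, …, S_r yields the sets of
  -- the theorem: B′ is the set of chosen points and T i j the pattern cell of
  -- the j-th pattern in S_i.  All vertices of T i j see B′ in the same way,
  -- and choosing the pattern of a subset S ⊆ B′ produces a vertex w with Γ(w) ∩ B′ = S.
  selection⇒shattered : {r t D : ℕ} (G : Graph n) (P : Fin n → Fin r) (B : Subset n) →
                        Selection (adj G) (partCell P) (elements B) t D → Shattered G P B t D
  selection⇒shattered {n} {r} {t} {D} G P B (selected β β∈B injective large) = record
    { B′         = image β
    ; B′⊆B       = λ v∈B′ → chosen∈B (∈-image⁻ β v∈B′)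
    ; ∣B′∣≡t      = ∣image∣ β injective
    ; T          = T
    ; T⊆part     = λ i j {v} v∈T → ∈-tabulate⁺ (cell-⊆ (adj G) (partCell P i) β (bits j) v (∈-tabulate⁻ v∈T))
    ; T-large    = λ i j → subst (λ s → n ≤ suc D * s) (sym (∣tabulate∣ (cell (adj G) (partCell P i) β (bits j))))
                                   (≤-trans (large i (bits j)) (*-monoˡ-≤ _ (n≤1+n D)))
    ; T-uniform  = λ i j u v u∈T v∈T →
                     trace-on-image β (λ k → trans (sees-pattern u∈T k) (sym (sees-pattern v∈T k)))
    ; T-shatters = shatters
    }
    where
    T : Fin r → Fin (2 ^ t) → Subset n
    T i j = tabulate (cell (adj G) (partCell P i) β (bits j))

    chosen∈B : ∀ {v} → ∃[ k ] β k ≡ v → v ∈ B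
    chosen∈B (k , refl) = All.lookup (elements⊆ B) (β∈B k)

    sees-pattern : ∀ {i j u} → u ∈ T i j → ∀ k → lookup (Γ G u) (β k) ≡ bits j k
    sees-pattern {i} {j} {u} u∈T k =
      trans (lookup∘tabulate (adj G u) (β k))
            (trans (Graph.sym G u (β k)) (cell-pattern (adj G) (partCell P i) β (bits j) u (∈-tabulate⁻ u∈T) k))

    shatters : (w : Fin (2 ^ t) → Fin n) → (∀ j → ∃[ i ] w j ∈ T i j) → Shatters G (image w) (image β)
    shatters w w∈T S S⊆B′ with bits-surjective (λ k → lookup S (β k))
    ... | j , bits-j≡S with w∈T j
    ... | i , wj∈T = w j , ∈-image w j ,
          trans (trace-on-image β (λ k → trans (sees-pattern wj∈T k) (bits-j≡S k))) (∩-⊆ S⊆B′)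

  -- The hypothesis of the theorem with αn replaced by n / E.
  SeparatedInParts : {r : ℕ} (E : ℕ) (G : Graph n) (P : Fin n → Fin r) (B : Subset n) → Set
  SeparatedInParts {n} E G P B =
    ∀ j b b′ → b ∈ B → b′ ∈ B → b ≢ b′ → n ≤ E * ∣ (Γ G b ∩ part P j) △ (Γ G b′ ∩ part P j) ∣

  shattering : (r t E : ℕ) → ∃[ N ] ∃[ D ]
               (∀ n (G : Graph n) (P : Fin n → Fin r) (B : Subset n) →
                N ≤ ∣ B ∣ → SeparatedInParts E G P B → Shattered G P B t D)
  shattering r t E with selection t r E
  ... | N , D , select = N , D , shatter
    where
    shatter : ∀ n (G : Graph n) (P : Fin n → Fin r) (B : Subset n) →
              N ≤ ∣ B ∣ → SeparatedInParts E G P B → Shattered G P B t D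
    shatter n G P B size far =
      selection⇒shattered G P B
        (select (adj G) (partCell P) (elements B) (subst (N ≤_) (sym (length-elements B)) size)
                (AllPairs-distinct (elements⊆ B) (elements-distinct B) separated))
      where
      separated : ∀ {b b′} → b ∈ B → b′ ∈ B → b ≢ b′ → ∀ j → n ≤ E * dist (partCell P j) (adj G b) (adj G b′)
      separated {b} {b′} b∈B b′∈B b≢b′ j =
        subst (λ e → n ≤ E * e) (distance-in-part G P j b b′) (far j b b′ b∈B b′∈B b≢b′)

open import Defs
open import Data.Nat using (ℕ; _^_; _≥_)
open import Data.Fin using (Fin)
open import Data.Fin.Subset using (Subset; _∩_; _∈_; _⊆_; ∣_∣)
open import Data.Rational using (ℚ; _*_; _≤_; Positive)
open import Data.Product using (Σ; ∃; _×_; _,_)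
open import Relation.Binary.PropositionalEquality using (_≡_)
open import Relation.Nullary using (¬_)
open Shattering using (ratio-bound; unitFraction; unitFraction-positive; unitFraction-bound; Shattered; shattering)

-- Trade α for the integer E with αn ≤ x ⇒ n ≤ Ex, apply the combinatorial
-- theorem, and trade its constant D back for δ = 1 / (D + 1).
lemma7 : (α : ℚ) → Positive α → (r t : ℕ) →
  Σ ℕ λ c → Σ ℚ λ δ → Positive δ ×
    ((n : ℕ) (G : Graph n) (P : Fin n → Fin r) (B : Subset n) →
      ∣ B ∣ ≥ c →
      (∀ (j : Fin r) b b' → b ∈ B → b' ∈ B → ¬ (b ≡ b') →
        α * ℕ→ℚ n ≤ ℕ→ℚ ∣ (Γ G b ∩ part P j) △ (Γ G b' ∩ part P j) ∣) →
      Σ (Subset n) λ B' → B' ⊆ B × ∣ B' ∣ ≡ t ×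
        Σ (Fin r → Fin (2 ^ t) → Subset n) λ T →
          (∀ i j → T i j ⊆ part P i) ×
          (∀ i j → δ * ℕ→ℚ n ≤ ℕ→ℚ ∣ T i j ∣) ×
          (∀ i j u v → u ∈ T i j → v ∈ T i j → Γ G u ∩ B' ≡ Γ G v ∩ B') ×
          ((w : Fin (2 ^ t) → Fin n) → (∀ j → ∃ λ i → w j ∈ T i j) →
            Shatters G (image w) B'))
lemma7 α α>0 r t =
  let (E , αn≤x⇒n≤Ex) = ratio-bound α α>0
      (N , D , shatter) = shattering r t E
  in N , unitFraction D , unitFraction-positive D , λ n G P B size α-far →
       let open Shattered (shatter n G P B size λ j b b′ b∈B b′∈B b≢b′ →
                             αn≤x⇒n≤Ex n _ (α-far j b b′ b∈B b′∈B b≢b′))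
       in B′ , B′⊆B , ∣B′∣≡t , T , T⊆part , (λ i j → unitFraction-bound D n ∣ T i j ∣ (T-large i j)) ,
          T-uniform , T-shatters
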